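{- If a graph $G$ with $n$ vertices contains a matching pair $(M_1,M_2)$ of size $X$, then the cost of $(1,2)$-TSP of $G$ is at most $2n-\frac{3}{4}X$.
   Context: A matching pair $(M_1,M_2)$ of $G$ is a pair of edge-disjoint matchings of $G$; its size is $|M_1|+|M_2|$. The $(1,2)$-TSP of $G$ is the TSP on the vertex set of $G$ with the metric in which $d(u,v)=1$ if $(u,v)$ is an edge of $G$ and $d(u,v)=2$ otherwise (for $u\ne v$); its cost is the minimum total distance of a Hamiltonian cycle on all $n$ vertices. -}

module Defs where

open import Data.Nat using (ℕ; zero; suc; _+_; _*_; _≤_)
open import Data.Fin using (Fin; _≟_)
open import Data.List using (List; []; _∷_; length; concatMap; allFin)
open import Data.List.Relation.Unary.Unique.Propositional using (Unique)
open import Data.List.Relation.Unary.All using (All)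
open import Data.List.Membership.Propositional using (_∈_)
open import Data.List.Relation.Binary.Permutation.Propositional using (_↭_)
open import Data.Product using (_×_; _,_; ∃)
open import Data.Sum using (_⊎_)
open import Relation.Binary.PropositionalEquality using (_≡_)
open import Relation.Nullary using (¬_; yes; no)
open import Relation.Binary.Definitions using (Decidable)

record Graph (n : ℕ) : Set₁ where
  field
    Adj    : Fin n → Fin n → Set
    adj?   : Decidable Adj
    sym    : ∀ {u v} → Adj u v → Adj v u
    irrefl : ∀ {u} → ¬ Adj u u
open Graph public

Edge : ℕ → Set
Edge n = Fin n × Fin n

endpoints : ∀ {n} → List (Edge n) → List (Fin n)
endpoints = concatMap (λ { (u , v) → u ∷ v ∷ [] })

-- A matching: a list of edges of G whose endpoints are pairwise distinct
-- (so edges are vertex-disjoint and no edge is repeated).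
IsMatching : ∀ {n} → Graph n → List (Edge n) → Set
IsMatching G M = All (λ { (u , v) → Adj G u v }) M × Unique (endpoints M)

SameEdge : ∀ {n} → Edge n → Edge n → Set
SameEdge (u , v) (a , b) = (u ≡ a × v ≡ b) ⊎ (u ≡ b × v ≡ a)

EdgeDisjoint : ∀ {n} → List (Edge n) → List (Edge n) → Set
EdgeDisjoint M₁ M₂ = ∀ {e f} → e ∈ M₁ → f ∈ M₂ → ¬ SameEdge e f

IsMatchingPair : ∀ {n} → Graph n → List (Edge n) → List (Edge n) → Set
IsMatchingPair G M₁ M₂ = IsMatching G M₁ × IsMatching G M₂ × EdgeDisjoint M₁ M₂

pairSize : ∀ {n} → List (Edge n) → List (Edge n) → ℕ
pairSize M₁ M₂ = length M₁ + length M₂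

dist : ∀ {n} → Graph n → Fin n → Fin n → ℕ
dist G u v with u ≟ v
... | yes _ = 0
... | no _ with adj? G u v
...   | yes _ = 1
...   | no _  = 2

IsTour : ∀ {n} → List (Fin n) → Set
IsTour {n} t = t ↭ allFin n

tourCost : ∀ {n} → Graph n → List (Fin n) → ℕ
tourCost G [] = 0
tourCost G (x ∷ xs) = walk x xs
  where
  walk : _ → List _ → ℕ
  walk cur [] = dist G cur x
  walk cur (y ∷ ys) = dist G cur y + walk y ys

IsTSPCost : ∀ {n} → Graph n → ℕ → Set
IsTSPCost G c = ∃ (λ t → IsTour t × tourCost G t ≡ c)
              × (∀ t → IsTour t → c ≤ tourCost G t)

module Submission where

-- Every vertex meets at most one edge of each matching, so M₁ ∪ M₂ splits the
-- vertex set into vertex-disjoint open paths (possibly single vertices) and cycles.  A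
-- cycle alternates between the two edge-disjoint matchings, so it has at least 4
-- vertices.  With a open paths and b cycles we have X = n − a.  Walking along every
-- component (dropping one edge of each cycle) and joining consecutive components by
-- jumps of weight at most 2 gives a tour of cost ≤ n + a + b; since a is at most the
-- number of vertices on paths and 4b at most the number on cycles,
--   4c + 3X ≤ 4(n + a + b) + 3(n − a) = 7n + a + 4b ≤ 8n.

open import Defs hiding (sym)
open import Data.Nat using (ℕ; suc; _+_; _*_; _≤_; z≤n; s≤s)
open import Data.Nat.Properties
  using (≤-refl; ≤-trans; ≤-reflexive; +-mono-≤; +-monoˡ-≤; +-monoʳ-≤; *-monoʳ-≤; +-cancelʳ-≤;
         m≤n+m; +-identityʳ; +-comm; +-assoc; +-suc; *-suc; *-zeroʳ; *-identityˡ; module ≤-Reasoning)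
open import Data.Nat.Tactic.RingSolver using (solve-∀)
open import Data.Fin using (Fin) renaming (_≟_ to _≟ᶠ_)
open import Data.List using (List; []; _∷_; [_]; _++_; _∷ʳ_; length; concat; map; reverse; allFin)
open import Data.List.Properties
  using (++-assoc; ++-identityʳ; length-++; length-map; length-reverse; length-tabulate;
         unfold-reverse; reverse-++; concat-++; concat-map-[_]; ∷ʳ-injective)
open import Data.List.Relation.Unary.All as All using (All; []; _∷_)
import Data.List.Relation.Unary.All.Properties as AllP
open import Data.List.Relation.Unary.Any using (here; there)
open import Data.List.Relation.Unary.Linked as Linked using (Linked; []; [-]; _∷_)
open import Data.List.Relation.Unary.AllPairs using (_∷_)
open import Data.List.Relation.Unary.Unique.Propositional using (Unique)
open import Data.List.Relation.Unary.Unique.Propositional.Properties using (Unique[x∷xs]⇒x∉xs)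
open import Data.List.Membership.Propositional using (_∈_; _∉_)
open import Data.List.Membership.Propositional.Properties
  using (∈-++⁺ˡ; ∈-++⁺ʳ; ∈-++⁻; ∈-∃++; ∈-concat⁻′; ∈-concat⁺′; ∈-map⁺; ∈-allFin)
open import Data.List.Relation.Binary.Subset.Propositional using (_⊆_)
open import Data.List.Relation.Binary.Subset.Propositional.Properties using (concatMap⁺)
open import Data.List.Relation.Binary.Permutation.Propositional
  using (_↭_; refl; prep; swap; ↭-refl; ↭-sym; ↭-trans; ↭-reflexive)
  renaming (trans to ↭-step)
open import Data.List.Relation.Binary.Permutation.Propositional.Properties
  using (++⁺ˡ; ++⁺ʳ; shift; shifts; ↭-length; ∈-resp-↭; All-resp-↭; ↭-reverse)
open import Data.Product using (_×_; _,_; ∃; ∃₂; proj₁; proj₂)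
open import Data.Sum using (_⊎_; inj₁; inj₂; map₁; map₂)
open import Data.Empty using (⊥; ⊥-elim)
open import Relation.Nullary using (yes; no)
open import Relation.Binary.PropositionalEquality using (_≡_; _≢_; refl; sym; trans; cong; cong₂; subst)

module _ {A : Set} where

  foldPrefixes : (P : List A → Set) (M : List A) →
                 (∀ D e R → D ++ e ∷ R ≡ M → P D → P (D ∷ʳ e)) → P [] → P M
  foldPrefixes P M step start = go [] M refl start
    where
    go : ∀ D R → D ++ R ≡ M → P D → P M
    go D []      eq p = subst P (trans (sym (++-identityʳ D)) eq) p
    go D (e ∷ R) eq p = go (D ∷ʳ e) R (trans (++-assoc D [ e ] R) eq) (step D e R eq p)

  unique-++-disjoint : ∀ xs {ys} {w : A} → Unique (xs ++ ys) → w ∈ xs → w ∉ ys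
  unique-++-disjoint (x ∷ xs) u (here refl) w∈ys = Unique[x∷xs]⇒x∉xs u (∈-++⁺ʳ xs w∈ys)
  unique-++-disjoint (x ∷ xs) (_ ∷ u) (there w∈xs) w∈ys = unique-++-disjoint xs u w∈xs w∈ys

  length-∷ʳ : ∀ (xs : List A) x → length (xs ∷ʳ x) ≡ suc (length xs)
  length-∷ʳ xs x = trans (length-++ xs) (+-comm (length xs) 1)

  concat⁺-↭ : ∀ {Os Os' : List (List A)} → Os ↭ Os' → concat Os ↭ concat Os'
  concat⁺-↭ refl         = refl
  concat⁺-↭ (prep P p)   = ++⁺ˡ P (concat⁺-↭ p)
  concat⁺-↭ (swap P Q p) = ↭-trans (shifts P Q) (++⁺ˡ Q (++⁺ˡ P (concat⁺-↭ p)))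
  concat⁺-↭ (↭-step p q) = ↭-trans (concat⁺-↭ p) (concat⁺-↭ q)

  findBlock : ∀ (Os : List (List A)) {w} → w ∈ concat Os →
              ∃₂ λ P Os₁ → (Os ↭ P ∷ Os₁) × w ∈ P
  findBlock Os w∈ with ∈-concat⁻′ Os w∈
  ... | P , w∈P , P∈Os with ∈-∃++ P∈Os
  ...   | as , bs , refl = P , as ++ bs , shift P as bs , w∈P

  concat-length-≥ : ∀ k (Ps : List (List A)) → All (λ P → k ≤ length P) Ps →
                    k * length Ps ≤ length (concat Ps)
  concat-length-≥ k []       []       = ≤-reflexive (*-zeroʳ k)
  concat-length-≥ k (P ∷ Ps) (h ∷ hs) = begin
    k * suc (length Ps)            ≡⟨ *-suc k (length Ps) ⟩
    k + k * length Ps              ≤⟨ +-mono-≤ h (concat-length-≥ k Ps hs) ⟩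
    length P + length (concat Ps)  ≡⟨ sym (length-++ P) ⟩
    length (concat (P ∷ Ps))       ∎
    where open ≤-Reasoning

module _ {A : Set} {R : A → A → Set} where

  linked-join : ∀ xs {u v} ys → Linked R (xs ∷ʳ u) → R u v → Linked R (v ∷ ys) →
                Linked R (xs ++ u ∷ v ∷ ys)
  linked-join []            ys _          r l = r ∷ l
  linked-join (x ∷ [])      ys (r₁ ∷ _)   r l = r₁ ∷ r ∷ l
  linked-join (x ∷ x' ∷ xs) ys (r₁ ∷ l₁)  r l = r₁ ∷ linked-join (x' ∷ xs) ys l₁ r l

  linked-reverse : (∀ {a b} → R a b → R b a) → ∀ {xs} → Linked R xs → Linked R (reverse xs)
  linked-reverse s []  = []
  linked-reverse s [-] = [-]
  linked-reverse s {x ∷ y ∷ xs} (r ∷ l) =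
    subst (Linked R) (sym reverse≡)
      (linked-join (reverse xs) [] (subst (Linked R) (unfold-reverse y xs) (linked-reverse s l)) (s r) [-])
    where
    reverse≡ : reverse (x ∷ y ∷ xs) ≡ reverse xs ++ y ∷ x ∷ []
    reverse≡ = trans (unfold-reverse x (y ∷ xs))
               (trans (cong (_∷ʳ x) (unfold-reverse y xs)) (++-assoc (reverse xs) [ y ] [ x ]))

  linked-last : ∀ xs {u} → Linked R (xs ∷ʳ u) → xs ≡ [] ⊎ ∃ λ y → R y u
  linked-last []            _       = inj₁ refl
  linked-last (x ∷ [])      (r ∷ _) = inj₂ (x , r)
  linked-last (x ∷ x' ∷ xs) (_ ∷ l) with linked-last (x' ∷ xs) l
  ... | inj₁ ()
  ... | inj₂ p = inj₂ p

-- Tour costs of path covers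

module TourCost {n : ℕ} (G : Graph n) where

  dist≤2 : ∀ u v → dist G u v ≤ 2
  dist≤2 u v with u ≟ᶠ v
  ... | yes _ = z≤n
  ... | no _ with adj? G u v
  ...   | yes _ = s≤s z≤n
  ...   | no _  = ≤-refl

  dist-adj : ∀ {u v} → Adj G u v → dist G u v ≡ 1
  dist-adj {u} {v} a with u ≟ᶠ v
  ... | yes refl = ⊥-elim (irrefl G a)
  ... | no _ with adj? G u v
  ...   | yes _ = refl
  ...   | no ¬a = ⊥-elim (¬a a)

  walkCost : List (Fin n) → ℕ
  walkCost []          = 0
  walkCost (x ∷ [])    = 0
  walkCost (x ∷ y ∷ r) = dist G x y + walkCost (y ∷ r)

  walkCost-path : ∀ {x} r → Linked (Adj G) (x ∷ r) → walkCost (x ∷ r) ≡ length r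
  walkCost-path []      _       = refl
  walkCost-path (y ∷ r) (a ∷ l) = cong₂ _+_ (dist-adj a) (walkCost-path r l)

  walkCost-++ : ∀ xs ys → walkCost (xs ++ ys) ≤ walkCost xs + 2 + walkCost ys
  walkCost-++ []            ys      = m≤n+m (walkCost ys) 2
  walkCost-++ (x ∷ [])      []      = z≤n
  walkCost-++ (x ∷ [])      (y ∷ _) = +-monoˡ-≤ _ (dist≤2 x y)
  walkCost-++ (x ∷ y ∷ xs)  ys      = begin
    dist G x y + walkCost ((y ∷ xs) ++ ys)               ≤⟨ +-monoʳ-≤ (dist G x y) (walkCost-++ (y ∷ xs) ys) ⟩
    dist G x y + (walkCost (y ∷ xs) + 2 + walkCost ys)   ≡⟨ regroup (dist G x y) (walkCost (y ∷ xs)) (walkCost ys) ⟩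
    dist G x y + walkCost (y ∷ xs) + 2 + walkCost ys     ∎
    where
    open ≤-Reasoning
    regroup : ∀ a b c → a + (b + 2 + c) ≡ a + b + 2 + c
    regroup = solve-∀

  -- Skipping the second vertex c of a tour x c d … replaces the legs x→c→d by x→d.
  tourCost-skip : ∀ x c d r →
    tourCost G (x ∷ c ∷ d ∷ r) + dist G x d ≡ dist G x c + dist G c d + tourCost G (x ∷ d ∷ r)
  tourCost-skip x c d r = regroup (dist G x c) (dist G c d) (dist G x d) _
    where
    regroup : ∀ a b e w → (a + (b + w)) + e ≡ a + b + (e + w)
    regroup = solve-∀

  tourCost≤walkCost : ∀ x r → tourCost G (x ∷ r) ≤ walkCost (x ∷ r) + 2
  tourCost≤walkCost x []          = dist≤2 x x
  tourCost≤walkCost x (c ∷ [])    = +-mono-≤ (≤-reflexive (sym (+-identityʳ (dist G x c)))) (dist≤2 c x)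
  tourCost≤walkCost x (c ∷ d ∷ r) = +-cancelʳ-≤ (dist G x d) _ _ (begin
    tourCost G (x ∷ c ∷ d ∷ r) + dist G x d          ≡⟨ tourCost-skip x c d r ⟩
    dist G x c + dist G c d + tourCost G (x ∷ d ∷ r) ≤⟨ +-monoʳ-≤ (dist G x c + dist G c d) (tourCost≤walkCost x (d ∷ r)) ⟩
    dist G x c + dist G c d + (dist G x d + walkCost (d ∷ r) + 2)
      ≡⟨ regroup (dist G x c) (dist G c d) (dist G x d) (walkCost (d ∷ r)) ⟩
    dist G x c + (dist G c d + walkCost (d ∷ r)) + 2 + dist G x d ∎)
    where
    open ≤-Reasoning
    regroup : ∀ a b e w → a + b + (e + w + 2) ≡ a + (b + w) + 2 + e
    regroup = solve-∀

  IsPath : List (Fin n) → Set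
  IsPath P = 1 ≤ length P × Linked (Adj G) P

  -- Walking through k nonempty G-paths with N vertices in total, one after the other,
  -- uses their N − k edges and k − 1 jumps of weight ≤ 2.
  walkCost-paths : ∀ P Ps → All IsPath (P ∷ Ps) →
                   walkCost (concat (P ∷ Ps)) + 2 ≤ length (concat (P ∷ Ps)) + length (P ∷ Ps)
  walkCost-paths []      _  ((() , _) ∷ _)
  walkCost-paths (x ∷ r) [] ((_ , l) ∷ [])
    rewrite ++-identityʳ r | walkCost-path r l = ≤-reflexive (lengths (length r))
    where
    lengths : ∀ k → k + 2 ≡ suc k + 1
    lengths = solve-∀
  walkCost-paths (x ∷ r) (Q ∷ Qs) ((_ , l) ∷ paths) = begin
    walkCost ((x ∷ r) ++ rest) + 2                  ≤⟨ +-monoˡ-≤ 2 (walkCost-++ (x ∷ r) rest) ⟩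
    walkCost (x ∷ r) + 2 + walkCost rest + 2        ≡⟨ cong (λ w → w + 2 + walkCost rest + 2) (walkCost-path r l) ⟩
    length r + 2 + walkCost rest + 2                ≡⟨ +-assoc (length r + 2) (walkCost rest) 2 ⟩
    length r + 2 + (walkCost rest + 2)              ≤⟨ +-monoʳ-≤ (length r + 2) (walkCost-paths Q Qs paths) ⟩
    length r + 2 + (length rest + length (Q ∷ Qs))  ≡⟨ regroup (length r) (length rest) (length Qs) ⟩
    suc (length r + length rest) + length ((x ∷ r) ∷ Q ∷ Qs)
      ≡⟨ cong (λ k → suc k + length ((x ∷ r) ∷ Q ∷ Qs)) (sym (length-++ r)) ⟩
    length ((x ∷ r) ++ rest) + length ((x ∷ r) ∷ Q ∷ Qs) ∎
    where
    open ≤-Reasoning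
    rest = concat (Q ∷ Qs)
    regroup : ∀ a b c → a + 2 + (b + suc c) ≡ suc (a + b) + suc (suc c)
    regroup = solve-∀

  tourCost-paths : ∀ Ps → All IsPath Ps → tourCost G (concat Ps) ≤ length (concat Ps) + length Ps
  tourCost-paths []             _     = z≤n
  tourCost-paths ([] ∷ Ps)      ((() , _) ∷ _)
  tourCost-paths ((x ∷ r) ∷ Ps) paths =
    ≤-trans (tourCost≤walkCost x (r ++ concat Ps)) (walkCost-paths (x ∷ r) Ps paths)

module _ {n : ℕ} where

  ends : Edge n → List (Fin n)
  ends (a , b) = a ∷ b ∷ []

  EdgeIn : List (Edge n) → Fin n → Fin n → Set
  EdgeIn D a b = ∃ λ e → e ∈ D × SameEdge (a , b) e

  ∈-endpoints : ∀ {D e w} → e ∈ D → w ∈ ends e → w ∈ endpoints D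
  ∈-endpoints {e = a , b} e∈D w∈e = ∈-concat⁺′ w∈e (∈-map⁺ _ e∈D)

  endpoints-⊆ : ∀ {D D' : List (Edge n)} → D ⊆ D' → endpoints D ⊆ endpoints D'
  endpoints-⊆ = concatMap⁺ _

  endpoints-++ : ∀ (D E : List (Edge n)) → endpoints (D ++ E) ≡ endpoints D ++ endpoints E
  endpoints-++ []            E = refl
  endpoints-++ ((a , b) ∷ D) E = cong (λ z → a ∷ b ∷ z) (endpoints-++ D E)

  sameEdge-ends : ∀ {a b : Fin n} {e} → SameEdge (a , b) e → a ∈ ends e × b ∈ ends e
  sameEdge-ends {e = _ , _} (inj₁ (refl , refl)) = here refl , there (here refl)
  sameEdge-ends {e = _ , _} (inj₂ (refl , refl)) = there (here refl) , here refl

  edgeIn-endpoints : ∀ {D a b} → EdgeIn D a b → a ∈ endpoints D × b ∈ endpoints D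
  edgeIn-endpoints (e , e∈D , same) =
    ∈-endpoints e∈D (proj₁ (sameEdge-ends same)) , ∈-endpoints e∈D (proj₂ (sameEdge-ends same))

  edgeIn-sym : ∀ {D a b} → EdgeIn D a b → EdgeIn D b a
  edgeIn-sym (e@(_ , _) , e∈D , inj₁ (p , q)) = e , e∈D , inj₂ (q , p)
  edgeIn-sym (e@(_ , _) , e∈D , inj₂ (p , q)) = e , e∈D , inj₁ (q , p)

  sameEdge-flip : ∀ {a b : Fin n} {e} → SameEdge (a , b) e → SameEdge e (b , a)
  sameEdge-flip {e = _ , _} (inj₁ (refl , refl)) = inj₂ (refl , refl)
  sameEdge-flip {e = _ , _} (inj₂ (refl , refl)) = inj₁ (refl , refl)

  sameEdge-pivot : ∀ {u v w : Fin n} {e} → SameEdge (v , w) e → SameEdge (w , u) e → u ≡ v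
  sameEdge-pivot {e = _ , _} (inj₁ (refl , refl)) (inj₁ (refl , refl)) = refl
  sameEdge-pivot {e = _ , _} (inj₁ (refl , refl)) (inj₂ (refl , refl)) = refl
  sameEdge-pivot {e = _ , _} (inj₂ (refl , refl)) (inj₁ (refl , refl)) = refl
  sameEdge-pivot {e = _ , _} (inj₂ (refl , refl)) (inj₂ (refl , refl)) = refl

  matching-shared-endpoint : ∀ (M : List (Edge n)) {e₁ e₂ w} → Unique (endpoints M) →
    e₁ ∈ M → e₂ ∈ M → w ∈ ends e₁ → w ∈ ends e₂ → e₁ ≡ e₂
  matching-shared-endpoint (_ ∷ M) uq (here refl) (here refl) _ _ = refl
  matching-shared-endpoint (_ ∷ M) uq (here refl) (there e₂∈M) w∈e₁ w∈e₂ =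
    ⊥-elim (fresh uq w∈e₁ (∈-endpoints e₂∈M w∈e₂))
    where
    fresh : ∀ {a b w} → Unique (a ∷ b ∷ endpoints M) → w ∈ a ∷ b ∷ [] → w ∉ endpoints M
    fresh uq       (here refl)         = λ m → Unique[x∷xs]⇒x∉xs uq (there m)
    fresh (_ ∷ uq) (there (here refl)) = Unique[x∷xs]⇒x∉xs uq
  matching-shared-endpoint (e ∷ M) uq (there e₁∈M) (here refl) w∈e₁ w∈e₂ =
    sym (matching-shared-endpoint (e ∷ M) uq (here refl) (there e₁∈M) w∈e₂ w∈e₁)
  matching-shared-endpoint ((_ , _) ∷ M) (_ ∷ _ ∷ uq) (there e₁∈M) (there e₂∈M) w∈e₁ w∈e₂ =
    matching-shared-endpoint M uq e₁∈M e₂∈M w∈e₁ w∈e₂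

  matching-two-steps : ∀ {M : List (Edge n)} {u v w} → Unique (endpoints M) →
    EdgeIn M v w → EdgeIn M w u → u ≡ v
  matching-two-steps {M} uq (e₁ , e₁∈M , same₁) (e₂ , e₂∈M , same₂)
    with matching-shared-endpoint M uq e₁∈M e₂∈M (proj₂ (sameEdge-ends same₁)) (proj₁ (sameEdge-ends same₂))
  ... | refl = sameEdge-pivot same₁ same₂

  matching-fresh : ∀ (D : List (Edge n)) {R u v} → Unique (endpoints (D ++ (u , v) ∷ R)) →
    u ∉ endpoints D × v ∉ endpoints D
  matching-fresh D {R} {u} {v} uq =
      (λ m → disjoint m (here refl)) , (λ m → disjoint m (there (here refl)))
    where
    disjoint : ∀ {w} → w ∈ endpoints D → w ∉ endpoints ((u , v) ∷ R)
    disjoint = unique-++-disjoint (endpoints D) (subst Unique (endpoints-++ D ((u , v) ∷ R)) uq)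

-- Decomposing M₁ ∪ M₂ into open paths and cycles
--
-- The decomposition is built by inserting edges one at a time.  The state after
-- inserting the edges D₁ of M₁ and D₂ of M₂ is a partition of the vertices into open
-- paths and cycles; a vertex inside an open path, or on a cycle, already meets an
-- edge of D₂, so the next edge of M₂ can only touch path ends.

module Decomposition {n : ℕ} (G : Graph n) where

  open TourCost G using (IsPath; tourCost-paths)

  Path : Set
  Path = List (Fin n)

  Link : List (Edge n) → List (Edge n) → Fin n → Fin n → Set
  Link D₁ D₂ a b = EdgeIn D₁ a b ⊎ EdgeIn D₂ a b

  link-sym : ∀ {D₁ D₂ a b} → Link D₁ D₂ a b → Link D₁ D₂ b a
  link-sym (inj₁ l) = inj₁ (edgeIn-sym l)
  link-sym (inj₂ l) = inj₂ (edgeIn-sym l)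

  link-mono : ∀ {D₁ D₂ D₁' D₂' a b} → D₁ ⊆ D₁' → D₂ ⊆ D₂' → Link D₁ D₂ a b → Link D₁' D₂' a b
  link-mono s₁ s₂ (inj₁ (e , e∈ , same)) = inj₁ (e , s₁ e∈ , same)
  link-mono s₁ s₂ (inj₂ (e , e∈ , same)) = inj₂ (e , s₂ e∈ , same)

  IsEnd : Fin n → Path → Set
  IsEnd w P = (∃ λ r → P ≡ w ∷ r) ⊎ (∃ λ r → P ≡ r ∷ʳ w)

  isEnd-reverse : ∀ {w P} → IsEnd w P → IsEnd w (reverse P)
  isEnd-reverse {w} (inj₁ (r , refl)) = inj₂ (reverse r , unfold-reverse w r)
  isEnd-reverse {w} (inj₂ (r , refl)) = inj₁ (reverse r , reverse-++ r [ w ])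

  record OpenPath (D₁ D₂ : List (Edge n)) (P : Path) : Set where
    field
      nonempty : 1 ≤ length P
      adjacent : Linked (Adj G) P
      linked   : Linked (Link D₁ D₂) P
      inner    : ∀ {w} → w ∈ P → w ∈ endpoints D₂ ⊎ IsEnd w P

  record Cycle (D₂ : List (Edge n)) (C : Path) : Set where
    field
      long     : 4 ≤ length C
      adjacent : Linked (Adj G) C
      covered  : ∀ {w} → w ∈ C → w ∈ endpoints D₂

  openPath-mono : ∀ {D₁ D₂ D₁' D₂' P} → D₁ ⊆ D₁' → D₂ ⊆ D₂' → OpenPath D₁ D₂ P → OpenPath D₁' D₂' P
  openPath-mono s₁ s₂ o = record
    { nonempty = nonempty
    ; adjacent = adjacent
    ; linked   = Linked.map (link-mono s₁ s₂) linked
    ; inner    = λ w∈ → map₁ (endpoints-⊆ s₂) (inner w∈)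
    }
    where open OpenPath o

  cycle-mono : ∀ {D₂ D₂' C} → D₂ ⊆ D₂' → Cycle D₂ C → Cycle D₂' C
  cycle-mono s c = record { long = long ; adjacent = adjacent ; covered = λ w∈ → endpoints-⊆ s (covered w∈) }
    where open Cycle c

  openPath-reverse : ∀ {D₁ D₂ P} → OpenPath D₁ D₂ P → OpenPath D₁ D₂ (reverse P)
  openPath-reverse {P = P} o = record
    { nonempty = subst (1 ≤_) (sym (length-reverse P)) nonempty
    ; adjacent = linked-reverse (Graph.sym G) adjacent
    ; linked   = linked-reverse link-sym linked
    ; inner    = λ w∈ → map₂ isEnd-reverse (inner (∈-resp-↭ (↭-reverse P) w∈))
    }
    where open OpenPath o

  -- A vertex of an open path not yet met by D₂ is an end, so the path can be turned
  -- to end (orientLast) or start (orientFirst) at it.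
  orientLast : ∀ {D₁ D₂ P w} → OpenPath D₁ D₂ P → w ∈ P → w ∉ endpoints D₂ →
               ∃ λ ys → (ys ∷ʳ w ↭ P) × OpenPath D₁ D₂ (ys ∷ʳ w)
  orientLast {D₁} {D₂} {P} {w} o w∈P w∉ with OpenPath.inner o w∈P
  ... | inj₁ w∈     = ⊥-elim (w∉ w∈)
  ... | inj₂ (inj₂ (r , refl)) = r , ↭-refl , o
  ... | inj₂ (inj₁ (r , refl)) =
    reverse r , subst (_↭ P) (unfold-reverse w r) (↭-reverse P) ,
    subst (OpenPath D₁ D₂) (unfold-reverse w r) (openPath-reverse o)

  orientFirst : ∀ {D₁ D₂ P w} → OpenPath D₁ D₂ P → w ∈ P → w ∉ endpoints D₂ →
                ∃ λ zs → (w ∷ zs ↭ P) × OpenPath D₁ D₂ (w ∷ zs)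
  orientFirst {D₁} {D₂} {P} {w} o w∈P w∉ with OpenPath.inner o w∈P
  ... | inj₁ w∈     = ⊥-elim (w∉ w∈)
  ... | inj₂ (inj₁ (r , refl)) = r , ↭-refl , o
  ... | inj₂ (inj₂ (r , refl)) =
    reverse r , subst (_↭ P) (reverse-++ r [ w ]) (↭-reverse P) ,
    subst (OpenPath D₁ D₂) (reverse-++ r [ w ]) (openPath-reverse o)

  -- The state after inserting D₁ ⊆ M₁ and D₂ ⊆ M₂: open paths Os and cycles Cs
  -- partitioning the vertices; each inserted edge has removed one open path.
  record Cover (D₁ D₂ : List (Edge n)) (Os Cs : List Path) : Set where
    field
      partition : concat Os ++ concat Cs ↭ allFin n
      opens     : All (OpenPath D₁ D₂) Os
      cycles    : All (Cycle D₂) Cs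
      count     : length Os + (length D₁ + length D₂) ≡ n

  initialCover : Cover [] [] (map [_] (allFin n)) []
  initialCover = record
    { partition = ↭-reflexive (trans (++-identityʳ _) (concat-map-[ allFin n ]))
    ; opens     = AllP.map⁺ (All.universal singleton (allFin n))
    ; cycles    = []
    ; count     = trans (+-identityʳ _) (trans (length-map [_] (allFin n)) (length-tabulate {n = n} (λ i → i)))
    }
    where
    singleton : ∀ w → OpenPath [] [] [ w ]
    singleton w = record
      { nonempty = s≤s z≤n ; adjacent = [-] ; linked = [-]
      ; inner = λ { (here refl) → inj₂ (inj₁ ([] , refl)) } }

  module _ {D₁ D₂ : List (Edge n)} where

    openAt : ∀ {Os Cs P Os₁} → Cover D₁ D₂ Os Cs → Os ↭ P ∷ Os₁ → OpenPath D₁ D₂ P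
    openAt cov σ = All.lookup (Cover.opens cov) (∈-resp-↭ (↭-sym σ) (here refl))

    cover-replace : ∀ {Os Cs P P' Os₁} → Cover D₁ D₂ Os Cs → Os ↭ P ∷ Os₁ → P' ↭ P →
                    OpenPath D₁ D₂ P' → Cover D₁ D₂ (P' ∷ Os₁) Cs
    cover-replace {Cs = Cs} {Os₁ = Os₁} cov σ ρ o = record
      { partition = ↭-trans (++⁺ʳ (concat Cs) (↭-trans (++⁺ʳ (concat Os₁) ρ) (concat⁺-↭ (↭-sym σ)))) partition
      ; opens     = o ∷ All.tail (All-resp-↭ σ opens)
      ; cycles    = cycles
      ; count     = trans (cong (_+ (length D₁ + length D₂)) (sym (↭-length σ))) count
      }
      where open Cover cov

    located : ∀ {Os Cs w} → Cover D₁ D₂ Os Cs → w ∉ endpoints D₂ → w ∈ concat Os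
    located {Os} {Cs} {w} cov w∉ with ∈-++⁻ (concat Os) (∈-resp-↭ (↭-sym (Cover.partition cov)) (∈-allFin w))
    ... | inj₁ w∈Os = w∈Os
    ... | inj₂ w∈Cs with ∈-concat⁻′ Cs w∈Cs
    ...   | C , w∈C , C∈Cs = ⊥-elim (w∉ (Cycle.covered (All.lookup (Cover.cycles cov) C∈Cs) w∈C))

    focusLast : ∀ {Os Cs u} → Cover D₁ D₂ Os Cs → u ∉ endpoints D₂ →
                ∃₂ λ ys Os₁ → Cover D₁ D₂ ((ys ∷ʳ u) ∷ Os₁) Cs
    focusLast {Os} cov u∉ with findBlock Os (located cov u∉)
    ... | P , Os₁ , σ , u∈P with orientLast (openAt cov σ) u∈P u∉
    ...   | ys , ρ , o = ys , Os₁ , cover-replace cov σ ρ o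

    focusFirst : ∀ {P Os Cs v} → Cover D₁ D₂ (P ∷ Os) Cs → v ∈ concat Os → v ∉ endpoints D₂ →
                 ∃₂ λ zs Os₁ → Cover D₁ D₂ ((v ∷ zs) ∷ P ∷ Os₁) Cs
    focusFirst {P} {Os} {Cs} {v} cov v∈ v∉ with findBlock Os v∈
    ... | Q , Os₁ , σ , v∈Q = continue (↭-trans (prep P σ) (swap P Q ↭-refl))
      where
      continue : P ∷ Os ↭ Q ∷ P ∷ Os₁ → ∃₂ λ zs Os₂ → Cover D₁ D₂ ((v ∷ zs) ∷ P ∷ Os₂) Cs
      continue τ with orientFirst (openAt cov τ) v∈Q v∉
      ... | zs , ρ , o = zs , Os₁ , cover-replace cov τ ρ o

  -- The last three fields are what the caller must know about the
  -- current paths: a nontrivial path ending at u (or starting at v) has u (or v)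
  -- saturated by D₂' after the insertion, and closing a path v … u into a cycle
  -- produces at least 4 vertices and saturates u and v.
  record Insertion (D₁ D₂ D₁' D₂' : List (Edge n)) (u v : Fin n) : Set where
    field
      old₁       : D₁ ⊆ D₁'
      old₂       : D₂ ⊆ D₂'
      grows      : length D₁' + length D₂' ≡ suc (length D₁ + length D₂)
      adjacent   : Adj G u v
      u-free     : u ∉ endpoints D₂
      v-free     : v ∉ endpoints D₂
      recorded   : Link D₁' D₂' u v
      u-end      : ∀ {ys} → OpenPath D₁ D₂ (ys ∷ʳ u) → ys ≡ [] ⊎ u ∈ endpoints D₂'
      v-end      : ∀ {zs} → OpenPath D₁ D₂ (v ∷ zs) → zs ≡ [] ⊎ v ∈ endpoints D₂'
      closesLong : ∀ {ys} → OpenPath D₁ D₂ (v ∷ ys ∷ʳ u) →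
                   4 ≤ length (v ∷ ys ∷ʳ u) × u ∈ endpoints D₂' × v ∈ endpoints D₂'

  module Insert {D₁ D₂ D₁' D₂' u v} (ins : Insertion D₁ D₂ D₁' D₂' u v) where
    open Insertion ins

    u≢v : u ≢ v
    u≢v refl = irrefl G adjacent

    join≡ : ∀ ys zs → ys ++ u ∷ v ∷ zs ≡ (ys ∷ʳ u) ++ v ∷ zs
    join≡ ys zs = sym (++-assoc ys [ u ] (v ∷ zs))

    leftEnd : ∀ ys zs {w} → IsEnd w (ys ∷ʳ u) → w ≡ u ⊎ IsEnd w (ys ++ u ∷ v ∷ zs)
    leftEnd []      zs (inj₁ (_ , refl)) = inj₁ refl
    leftEnd (y ∷ _) zs (inj₁ (_ , refl)) = inj₂ (inj₁ (_ , refl))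
    leftEnd ys      zs (inj₂ (r , eq))   = inj₁ (sym (proj₂ (∷ʳ-injective ys r eq)))

    rightEnd : ∀ ys zs {w} → IsEnd w (v ∷ zs) → w ≡ v ⊎ IsEnd w (ys ++ u ∷ v ∷ zs)
    rightEnd ys zs (inj₁ (_ , refl)) = inj₁ refl
    rightEnd ys zs {w} (inj₂ (r , eq)) =
      inj₂ (inj₂ (ys ++ u ∷ r , trans (cong (λ k → ys ++ u ∷ k) eq) (sym (++-assoc ys (u ∷ r) [ w ]))))

    u-after : ∀ ys zs → ys ≡ [] ⊎ u ∈ endpoints D₂' → u ∈ endpoints D₂' ⊎ IsEnd u (ys ++ u ∷ v ∷ zs)
    u-after .[] zs (inj₁ refl) = inj₂ (inj₁ (_ , refl))
    u-after ys  zs (inj₂ u∈)   = inj₁ u∈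

    v-after : ∀ ys zs → zs ≡ [] ⊎ v ∈ endpoints D₂' → v ∈ endpoints D₂' ⊎ IsEnd v (ys ++ u ∷ v ∷ zs)
    v-after ys .[] (inj₁ refl) = inj₂ (inj₂ (ys ∷ʳ u , sym (++-assoc ys [ u ] [ v ])))
    v-after ys zs  (inj₂ v∈)   = inj₁ v∈

    openPath-merge : ∀ ys zs → OpenPath D₁ D₂ (ys ∷ʳ u) → OpenPath D₁ D₂ (v ∷ zs) →
                     OpenPath D₁' D₂' (ys ++ u ∷ v ∷ zs)
    openPath-merge ys zs o₁ o₂ = record
      { nonempty = subst (1 ≤_) (sym (length-++ ys)) (≤-trans (s≤s z≤n) (m≤n+m _ (length ys)))
      ; adjacent = linked-join ys zs (OpenPath.adjacent o₁) adjacent (OpenPath.adjacent o₂)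
      ; linked   = linked-join ys zs (Linked.map (link-mono old₁ old₂) (OpenPath.linked o₁)) recorded
                                     (Linked.map (link-mono old₁ old₂) (OpenPath.linked o₂))
      ; inner    = inner
      }
      where
      inner : ∀ {w} → w ∈ ys ++ u ∷ v ∷ zs → w ∈ endpoints D₂' ⊎ IsEnd w (ys ++ u ∷ v ∷ zs)
      inner {w} w∈ with ∈-++⁻ (ys ∷ʳ u) (subst (w ∈_) (join≡ ys zs) w∈)
      ... | inj₁ w∈₁ with OpenPath.inner o₁ w∈₁
      ...   | inj₁ t = inj₁ (endpoints-⊆ old₂ t)
      ...   | inj₂ e with leftEnd ys zs e
      ...     | inj₁ refl = u-after ys zs (u-end o₁)
      ...     | inj₂ e'   = inj₂ e'
      inner {w} w∈ | inj₂ w∈₂ with OpenPath.inner o₂ w∈₂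
      ...   | inj₁ t = inj₁ (endpoints-⊆ old₂ t)
      ...   | inj₂ e with rightEnd ys zs e
      ...     | inj₁ refl = v-after ys zs (v-end o₂)
      ...     | inj₂ e'   = inj₂ e'

    closedEnds : ∀ ys {w} → IsEnd w (v ∷ ys ∷ʳ u) → w ≡ v ⊎ w ≡ u
    closedEnds ys (inj₁ (_ , refl)) = inj₁ refl
    closedEnds ys (inj₂ (r , eq))   = inj₂ (sym (proj₂ (∷ʳ-injective (v ∷ ys) r eq)))

    closingPath : ∀ {ys} → OpenPath D₁ D₂ (ys ∷ʳ u) → v ∈ ys ∷ʳ u → ∃ λ ys' → ys ≡ v ∷ ys'
    closingPath {ys} o v∈ with OpenPath.inner o v∈
    ... | inj₁ v∈D₂ = ⊥-elim (v-free v∈D₂)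
    ... | inj₂ (inj₂ (r , eq)) = ⊥-elim (u≢v (proj₂ (∷ʳ-injective ys r eq)))
    closingPath {[]}     o v∈ | inj₂ (inj₁ (_ , refl)) = ⊥-elim (u≢v refl)
    closingPath {_ ∷ ys} o v∈ | inj₂ (inj₁ (_ , refl)) = ys , refl

    closeCycle : ∀ {ys Os Cs} → Cover D₁ D₂ ((v ∷ ys ∷ʳ u) ∷ Os) Cs →
                 Cover D₁' D₂' Os ((v ∷ ys ∷ʳ u) ∷ Cs)
    closeCycle {ys} {Os} {Cs} cov = record
      { partition = ↭-trans (↭-trans (shifts (concat Os) C) (↭-reflexive (sym (++-assoc C (concat Os) (concat Cs)))))
                            partition
      ; opens     = All.map (openPath-mono old₁ old₂) (All.tail opens)
      ; cycles    = cycle ∷ All.map (cycle-mono old₂) cycles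
      ; count     = trans (cong (length Os +_) grows) (trans (+-suc (length Os) _) count)
      }
      where
      open Cover cov
      C = v ∷ ys ∷ʳ u
      path : OpenPath D₁ D₂ C
      path = All.head opens
      covered : ∀ {w} → w ∈ C → w ∈ endpoints D₂'
      covered w∈ with OpenPath.inner path w∈
      ... | inj₁ t = endpoints-⊆ old₂ t
      ... | inj₂ e with closedEnds ys e
      ...   | inj₁ refl = proj₂ (proj₂ (closesLong path))
      ...   | inj₂ refl = proj₁ (proj₂ (closesLong path))
      cycle : Cycle D₂' C
      cycle = record { long = proj₁ (closesLong path) ; adjacent = OpenPath.adjacent path ; covered = covered }

    mergePaths : ∀ {ys zs Os Cs} → Cover D₁ D₂ ((v ∷ zs) ∷ (ys ∷ʳ u) ∷ Os) Cs →
                 Cover D₁' D₂' ((ys ++ u ∷ v ∷ zs) ∷ Os) Cs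
    mergePaths {ys} {zs} {Os} {Cs} cov = record
      { partition = ↭-trans (++⁺ʳ (concat Cs) rearrange) partition
      ; opens     = openPath-merge ys zs (All.head (All.tail opens)) (All.head opens)
                    ∷ All.map (openPath-mono old₁ old₂) (All.tail (All.tail opens))
      ; cycles    = All.map (cycle-mono old₂) cycles
      ; count     = trans (cong (suc (length Os) +_) grows) (trans (+-suc (suc (length Os)) _) count)
      }
      where
      open Cover cov
      rearrange : (ys ++ u ∷ v ∷ zs) ++ concat Os ↭ (v ∷ zs) ++ (ys ∷ʳ u) ++ concat Os
      rearrange = ↭-trans (↭-reflexive (trans (cong (_++ concat Os) (join≡ ys zs)) (++-assoc (ys ∷ʳ u) (v ∷ zs) (concat Os))))
                          (shifts (ys ∷ʳ u) (v ∷ zs))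

    insert : ∀ {Os Cs} → Cover D₁ D₂ Os Cs → ∃₂ (Cover D₁' D₂')
    insert cov with focusLast cov u-free
    ... | ys , Os₁ , cov₁ with ∈-++⁻ (ys ∷ʳ u) (located cov₁ v-free)
    ...   | inj₁ v∈path with closingPath (All.head (Cover.opens cov₁)) v∈path
    ...     | _ , refl = _ , _ , closeCycle cov₁
    insert cov | ys , Os₁ , cov₁ | inj₂ v∈rest with focusFirst cov₁ v∈rest v-free
    ...     | _ , _ , cov₂ = _ , _ , mergePaths cov₂

  unlinked : ∀ {D₁ D₂ w x} → w ∉ endpoints D₁ → w ∉ endpoints D₂ → Link D₁ D₂ w x → ⊥
  unlinked w∉₁ w∉₂ (inj₁ l) = w∉₁ (proj₁ (edgeIn-endpoints l))
  unlinked w∉₁ w∉₂ (inj₂ l) = w∉₂ (proj₁ (edgeIn-endpoints l))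

  aloneLast : ∀ {D₁ D₂ u} ys → u ∉ endpoints D₁ → u ∉ endpoints D₂ → Linked (Link D₁ D₂) (ys ∷ʳ u) → ys ≡ []
  aloneLast ys u∉₁ u∉₂ l with linked-last ys l
  ... | inj₁ ys≡[]     = ys≡[]
  ... | inj₂ (_ , yu) = ⊥-elim (unlinked u∉₁ u∉₂ (link-sym yu))

  aloneFirst : ∀ {D₁ D₂ v zs} → v ∉ endpoints D₁ → v ∉ endpoints D₂ → Linked (Link D₁ D₂) (v ∷ zs) → zs ≡ []
  aloneFirst v∉₁ v∉₂ [-]      = refl
  aloneFirst v∉₁ v∉₂ (vz ∷ _) = ⊥-elim (unlinked v∉₁ v∉₂ vz)

  -- Inserting the next edge uv of M₁, before any edge of M₂: u and v are still
  -- untouched, hence single-vertex paths that get merged.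
  insertion₁ : ∀ {M₁} → IsMatching G M₁ → ∀ D {u v R} → D ++ (u , v) ∷ R ≡ M₁ →
               Insertion D [] (D ∷ʳ (u , v)) [] u v
  insertion₁ (edges , unique) D {u} {v} refl = record
    { old₁       = ∈-++⁺ˡ
    ; old₂       = λ ()
    ; grows      = cong (_+ 0) (length-∷ʳ D (u , v))
    ; adjacent   = All.lookup edges (∈-++⁺ʳ D (here refl))
    ; u-free     = λ ()
    ; v-free     = λ ()
    ; recorded   = inj₁ ((u , v) , ∈-++⁺ʳ D (here refl) , inj₁ (refl , refl))
    ; u-end      = λ {ys} o → inj₁ (aloneLast ys u∉ (λ ()) (OpenPath.linked o))
    ; v-end      = λ o → inj₁ (aloneFirst v∉ (λ ()) (OpenPath.linked o))
    ; closesLong = λ {ys} o → ⊥-elim (noPathFromV ys (aloneLast (v ∷ ys) u∉ (λ ()) (OpenPath.linked o)))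
    }
    where
    u∉ : u ∉ endpoints D
    u∉ = proj₁ (matching-fresh D unique)
    v∉ : v ∉ endpoints D
    v∉ = proj₂ (matching-fresh D unique)
    noPathFromV : ∀ ys → v ∷ ys ≢ []
    noPathFromV ys ()

  -- Closing a path v … u creates
  -- no 2-cycle (the matchings are edge-disjoint) and no triangle (two consecutive
  -- edges of M₁ would share a vertex), so the cycle has at least 4 vertices.
  insertion₂ : ∀ {M₁ M₂} → IsMatchingPair G M₁ M₂ → ∀ D {u v R} → D ++ (u , v) ∷ R ≡ M₂ →
               Insertion M₁ D M₁ (D ∷ʳ (u , v)) u v
  insertion₂ {M₁} ((_ , unique₁) , (edges₂ , unique₂) , disjoint) D {u} {v} refl = record
    { old₁       = λ e∈ → e∈
    ; old₂       = ∈-++⁺ˡ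
    ; grows      = trans (cong (length M₁ +_) (length-∷ʳ D (u , v))) (+-suc (length M₁) (length D))
    ; adjacent   = uv
    ; u-free     = u∉
    ; v-free     = v∉
    ; recorded   = inj₂ ((u , v) , ∈-++⁺ʳ D (here refl) , inj₁ (refl , refl))
    ; u-end      = λ _ → inj₂ u∈
    ; v-end      = λ _ → inj₂ v∈
    ; closesLong = λ o → noShortCycle (OpenPath.linked o) , u∈ , v∈
    }
    where
    uv : Adj G u v
    uv = All.lookup edges₂ (∈-++⁺ʳ D (here refl))
    u∉ : u ∉ endpoints D
    u∉ = proj₁ (matching-fresh D unique₂)
    v∉ : v ∉ endpoints D
    v∉ = proj₂ (matching-fresh D unique₂)
    u∈ : u ∈ endpoints (D ∷ʳ (u , v))
    u∈ = ∈-endpoints (∈-++⁺ʳ D (here refl)) (here refl)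
    v∈ : v ∈ endpoints (D ∷ʳ (u , v))
    v∈ = ∈-endpoints (∈-++⁺ʳ D (here refl)) (there (here refl))
    noShortCycle : ∀ {ys} → Linked (Link M₁ D) (v ∷ ys ∷ʳ u) → 4 ≤ length (v ∷ ys ∷ʳ u)
    noShortCycle {[]}     (inj₁ (e , e∈M₁ , same) ∷ [-]) =
      ⊥-elim (disjoint e∈M₁ (∈-++⁺ʳ D (here refl)) (sameEdge-flip same))
    noShortCycle {[]}     (inj₂ vu ∷ [-])              = ⊥-elim (v∉ (proj₁ (edgeIn-endpoints vu)))
    noShortCycle {_ ∷ []} (_ ∷ inj₂ wu ∷ [-])          = ⊥-elim (u∉ (proj₂ (edgeIn-endpoints wu)))
    noShortCycle {_ ∷ []} (inj₂ vw ∷ inj₁ _ ∷ [-])     = ⊥-elim (v∉ (proj₁ (edgeIn-endpoints vw)))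
    noShortCycle {_ ∷ []} (inj₁ vw ∷ inj₁ wu ∷ [-])    =
      ⊥-elim (irrefl G (subst (λ x → Adj G x v) (matching-two-steps unique₁ vw wu) uv))
    noShortCycle {_ ∷ _ ∷ ys} _ = s≤s (s≤s (s≤s (subst (1 ≤_) (sym (length-∷ʳ ys u)) (s≤s z≤n))))

  decompose : ∀ {M₁ M₂} → IsMatchingPair G M₁ M₂ → ∃₂ (Cover M₁ M₂)
  decompose {M₁} {M₂} pair =
    foldPrefixes (λ D → ∃₂ (Cover M₁ D)) M₂ insert₂
      (foldPrefixes (λ D → ∃₂ (Cover D [])) M₁ insert₁ (_ , _ , initialCover))
    where
    insert₁ : ∀ D e R → D ++ e ∷ R ≡ M₁ → ∃₂ (Cover D []) → ∃₂ (Cover (D ∷ʳ e) [])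
    insert₁ D (u , v) R eq (_ , _ , cov) = Insert.insert (insertion₁ (proj₁ pair) D eq) cov
    insert₂ : ∀ D e R → D ++ e ∷ R ≡ M₂ → ∃₂ (Cover M₁ D) → ∃₂ (Cover M₁ (D ∷ʳ e))
    insert₂ D (u , v) R eq (_ , _ , cov) = Insert.insert (insertion₂ pair D eq) cov

  coverTour : ∀ {D₁ D₂ Os Cs} → Cover D₁ D₂ Os Cs →
              ∃ λ T → IsTour T × tourCost G T ≤ n + (length Os + length Cs)
  coverTour {Os = Os} {Cs} cov = concat (Os ++ Cs) , tour , cost
    where
    open Cover cov
    tour : concat (Os ++ Cs) ↭ allFin n
    tour = ↭-trans (↭-reflexive (sym (concat-++ Os Cs))) partition
    paths : All IsPath (Os ++ Cs)
    paths = AllP.++⁺ (All.map (λ o → OpenPath.nonempty o , OpenPath.adjacent o) opens)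
                     (All.map (λ c → ≤-trans (s≤s z≤n) (Cycle.long c) , Cycle.adjacent c) cycles)
    vertices : length (concat (Os ++ Cs)) ≡ n
    vertices = trans (↭-length tour) (length-tabulate {n = n} (λ i → i))
    cost : tourCost G (concat (Os ++ Cs)) ≤ n + (length Os + length Cs)
    cost = ≤-trans (tourCost-paths (Os ++ Cs) paths) (≤-reflexive (cong₂ _+_ vertices (length-++ Os)))

  coverSizes : ∀ {D₁ D₂ Os Cs} → Cover D₁ D₂ Os Cs →
               length Os ≤ length (concat Os) × 4 * length Cs ≤ length (concat Cs) ×
               length (concat Os) + length (concat Cs) ≡ n
  coverSizes {Os = Os} {Cs} cov =
      subst (_≤ length (concat Os)) (*-identityˡ (length Os)) (concat-length-≥ 1 Os (All.map OpenPath.nonempty opens))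
    , concat-length-≥ 4 Cs (All.map Cycle.long cycles)
    , trans (sym (length-++ (concat Os))) (trans (↭-length partition) (length-tabulate {n = n} (λ i → i)))
    where open Cover cov

tsp-arithmetic : ∀ {n c X a b A B} → c ≤ n + (a + b) → a ≤ A → 4 * b ≤ B → A + B ≡ n → a + X ≡ n →
                 4 * c + 3 * X ≤ 8 * n
tsp-arithmetic {n} {c} {X} {a} {b} {A} {B} c≤ a≤A 4b≤B vertices edges = begin
  4 * c + 3 * X                      ≤⟨ +-monoˡ-≤ (3 * X) (*-monoʳ-≤ 4 c≤) ⟩
  4 * (n + (a + b)) + 3 * X          ≡⟨ regroup n a b X ⟩
  4 * n + 3 * (a + X) + (a + 4 * b)  ≤⟨ +-monoʳ-≤ (4 * n + 3 * (a + X)) (+-mono-≤ a≤A 4b≤B) ⟩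
  4 * n + 3 * (a + X) + (A + B)      ≡⟨ cong₂ (λ p q → 4 * n + 3 * p + q) edges vertices ⟩
  4 * n + 3 * n + n                  ≡⟨ collect n ⟩
  8 * n                              ∎
  where
  open ≤-Reasoning
  regroup : ∀ n a b X → 4 * (n + (a + b)) + 3 * X ≡ 4 * n + 3 * (a + X) + (a + 4 * b)
  regroup = solve-∀
  collect : ∀ n → 4 * n + 3 * n + n ≡ 8 * n
  collect = solve-∀

mainTheorem20 : (n : ℕ) (G : Graph n) (M₁ M₂ : List (Edge n)) (X c : ℕ) →
    IsMatchingPair G M₁ M₂ → pairSize M₁ M₂ ≡ X → IsTSPCost G c →
    4 * c + 3 * X ≤ 8 * n
mainTheorem20 n G M₁ M₂ X c pair refl (_ , optimal) =
  let open Decomposition G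
      Os , Cs , cover                  = decompose pair
      T , isTour , cost                = coverTour cover
      paths≤ , cycles≤ , allVertices   = coverSizes cover
  in tsp-arithmetic (≤-trans (optimal T isTour) cost) paths≤ cycles≤ allVertices (Cover.count cover)
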